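{- Let $G$ be a partizan Kayles position (a disjunctive sum of strips) containing $x$ strips whose length is congruent to $1$ modulo $3$ and $y$ strips whose length is congruent to $2$ modulo $3$. Then the misère outcome of $G$ is $$o^-(G)=\begin{cases}\mathcal{N}, & \text{if } x=y, \text{ or if } x<y \text{ and } x+2y\equiv 0 \pmod 3,\\ \mathcal{R}, & \text{if } x>y, \text{ or if } x<y \text{ and } x+2y\equiv 1 \pmod 3,\\ \mathcal{P}, & \text{if } x<y \text{ and } x+2y\equiv 2\pmod 3.\end{cases}$$
   Context: Partizan Kayles is played on $1\times n$ strips of squares; $S_n$ denotes an empty strip of length $n$. Left moves by placing a single square on one empty cell; Right moves by placing a domino covering two adjacent empty cells of the same strip; a placement splits a strip into the strips of empty cells on either side, so positions are disjunctive sums of strips. Under misère play a player unable to move on their turn wins. The outcome is $\mathcal{L}$ (Left wins moving first or second), $\mathcal{R}$ (Right wins moving first or second), $\mathcal{N}$ (the first player wins) or $\mathcal{P}$ (the second player wins). -}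

module Defs where

open import Data.Nat using (ℕ; zero; suc; _+_; _%_)
open import Data.List using (List; []; _∷_; length; filter)
open import Data.Product using (_×_; Σ; ∃)
open import Relation.Nullary using (¬_)
open import Relation.Binary.PropositionalEquality using (_≡_)
open import Data.Nat using (_≟_)

-- A partizan Kayles position: a disjunctive sum of strips, given by the
-- list of the lengths of its empty strips (S_n ↦ n).
Position : Set
Position = List ℕ

data Player : Set where
  Left Right : Player

opp : Player → Player
opp Left  = Right
opp Right = Left

-- number of cells a player's piece covers: Left a square, Right a domino
size : Player → ℕ
size Left  = 1
size Right = 2

data Move (p : Player) : Position → Position → Set where
  here  : ∀ {n rest} (a b : ℕ) → a + size p + b ≡ n →
          Move p (n ∷ rest) (a ∷ b ∷ rest)
  there : ∀ {n G G'} → Move p G G' → Move p (n ∷ G) (n ∷ G')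

-- Misère play: Wins p q G means player p has a winning strategy in G
-- when player q is to move; a player unable to move on their turn wins.
data Wins (p : Player) : Player → Position → Set where
  stuck  : ∀ {G} → ¬ (∃ λ G' → Move p G G') → Wins p p G
  good   : ∀ {G G'} → Move p G G' → Wins p (opp p) G' → Wins p p G
  forced : ∀ {G} → (∃ λ G' → Move (opp p) G G') →
           (∀ {G'} → Move (opp p) G G' → Wins p p G') → Wins p (opp p) G

data Outcome : Set where
  𝓛 𝓡 𝓝 𝓟 : Outcome

HasOutcome : Position → Outcome → Set
HasOutcome G 𝓛 = Wins Left Left G × Wins Left Right G
HasOutcome G 𝓡 = Wins Right Right G × Wins Right Left G
HasOutcome G 𝓝 = Wins Left Left G × Wins Right Right G
HasOutcome G 𝓟 = Wins Left Right G × Wins Right Left G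

count : ℕ → Position → ℕ
count r G = length (filter (λ n → n % 3 ≟ r) G)

-- Let y − x be computed strip by strip (`balance`): a strip contributes 0, −1 or +1 as its
-- length is 0, 1 or 2 mod 3. A move replaces a strip by two shorter ones, and a finite check
-- of residues shows that a Left move changes the balance by +1 or −2 and a Right move by −1
-- or +2. Moving first from a balance in 3ℕ, Left can move into 3ℕ + 1 (by +1, or by −2 from a
-- positive balance) unless she has no move at all, while every Right move from 3ℕ + 1 lands
-- in 3ℕ; and Right, whenever he can move, can lower the balance by one. So Left wins moving
-- first iff the balance lies in 3ℕ, and moving second iff it lies in 3ℕ + 1. As
-- x + 2y ≡ 2(y − x) (mod 3), these are the cases 𝓝 and 𝓟 of the theorem; all others are 𝓡.

module Submission where

open import Defs
open import Data.Nat using (ℕ; _+_; _*_; _%_; _<_; _>_)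
open import Data.Product using (_×_)
open import Data.Sum using (_⊎_)
open import Relation.Binary.PropositionalEquality using (_≡_)

open import Data.Nat using (zero; suc; _≤_; s≤s; z<s; s<s; _≟_; _∸_; _/_)
open import Data.Nat.Properties
  using (+-comm; <⇒≤; <⇒≱; ≤-trans; m≤m+n; m≤n+m; m<n+m; +-monoʳ-<; m+[n∸m]≡n)
open import Data.Nat.DivMod using ([m+kn]%n≡m%n; m<n⇒m%n≡m; m≡m%n+[m/n]*n; m%n<n; %-distribˡ-*)
open import Data.Nat.Induction using (<-wellFounded)
open import Data.Nat.Tactic.RingSolver using (solve-∀)
open import Data.Integer as ℤ using (ℤ; +_; 0ℤ; 1ℤ; -1ℤ; _⊖_)
import Data.Integer.Properties as ℤₚ
open import Algebra.Properties.AbelianGroup ℤₚ.+-0-abelianGroup using (//-rightDividesʳ)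
open import Algebra.Properties.CommutativeSemigroup ℤₚ.+-commutativeSemigroup using (xy∙z≈xz∙y)
open import Data.List using ([]; _∷_; length)
open import Data.Nat.ListAction using (sum)
open import Data.List.Properties using (filter-accept; filter-reject)
open import Data.Product using (∃; ∃₂; _,_; ∃-syntax)
open import Data.Sum using (inj₁; inj₂)
open import Data.Empty using (⊥-elim)
open import Function using (_∘_)
open import Induction.WellFounded using (Acc; acc)
open import Relation.Nullary using (¬_)
open import Relation.Binary.PropositionalEquality
  using (_≢_; refl; sym; trans; cong; cong₂; subst; module ≡-Reasoning)

open ≡-Reasoning

weight : ℕ → ℤ
weight 0 = 0ℤ
weight 1 = -1ℤ
weight 2 = 1ℤ
weight (suc (suc (suc n))) = weight n

balance : Position → ℤ
balance []      = 0ℤ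
balance (n ∷ G) = weight n ℤ.+ balance G

m+[3+n]≡3+[m+n] : ∀ m n → m + (3 + n) ≡ 3 + (m + n)
m+[3+n]≡3+[m+n] = solve-∀

data Shift : Player → ℤ → Set where
  left-step  : Shift Left  1ℤ
  left-jump  : Shift Left  (ℤ.- + 2)
  right-step : Shift Right -1ℤ
  right-jump : Shift Right (+ 2)

Shifted : Player → ℤ → ℤ → Set
Shifted p d d' = ∃[ c ] Shift p c × d' ≡ d ℤ.+ c

shift-back : ∀ {d d' c} → d' ≡ d ℤ.+ c → d ≡ d' ℤ.- c
shift-back {d} {c = c} refl = sym (//-rightDividesʳ c d)

shifted-left⇒right : ∀ {d d'} → Shifted Left d d' → Shifted Right d' d
shifted-left⇒right (_ , left-step , e) = _ , right-step , shift-back e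
shifted-left⇒right (_ , left-jump , e) = _ , right-jump , shift-back e

strip-shift : ∀ p a b → Shifted p (weight (a + size p + b)) (weight a ℤ.+ weight b)
strip-shift p (suc (suc (suc a))) b = strip-shift p a b
strip-shift p a (suc (suc (suc b))) rewrite m+[3+n]≡3+[m+n] (a + size p) b = strip-shift p a b
strip-shift Left  0 0 = _ , left-step  , refl
strip-shift Left  0 1 = _ , left-jump  , refl
strip-shift Left  0 2 = _ , left-step  , refl
strip-shift Left  1 0 = _ , left-jump  , refl
strip-shift Left  1 1 = _ , left-jump  , refl
strip-shift Left  1 2 = _ , left-step  , refl
strip-shift Left  2 0 = _ , left-step  , refl
strip-shift Left  2 1 = _ , left-step  , refl
strip-shift Left  2 2 = _ , left-step  , refl
strip-shift Right 0 0 = _ , right-step , refl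
strip-shift Right 0 1 = _ , right-step , refl
strip-shift Right 0 2 = _ , right-jump , refl
strip-shift Right 1 0 = _ , right-step , refl
strip-shift Right 1 1 = _ , right-step , refl
strip-shift Right 1 2 = _ , right-step , refl
strip-shift Right 2 0 = _ , right-jump , refl
strip-shift Right 2 1 = _ , right-step , refl
strip-shift Right 2 2 = _ , right-jump , refl

balance-here : ∀ a b n {c} G → weight a ℤ.+ weight b ≡ weight n ℤ.+ c →
               balance (a ∷ b ∷ G) ≡ balance (n ∷ G) ℤ.+ c
balance-here a b n {c} G e = begin
  weight a ℤ.+ (weight b ℤ.+ balance G)  ≡⟨ ℤₚ.+-assoc (weight a) (weight b) (balance G) ⟨
  weight a ℤ.+ weight b ℤ.+ balance G    ≡⟨ cong (ℤ._+ balance G) e ⟩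
  weight n ℤ.+ c ℤ.+ balance G           ≡⟨ xy∙z≈xz∙y (weight n) c (balance G) ⟩
  weight n ℤ.+ balance G ℤ.+ c           ∎

balance-there : ∀ n {G G' c} → balance G' ≡ balance G ℤ.+ c →
                balance (n ∷ G') ≡ balance (n ∷ G) ℤ.+ c
balance-there n {G} {c = c} e =
  trans (cong (ℤ._+_ (weight n)) e) (sym (ℤₚ.+-assoc (weight n) (balance G) c))

move-shift : ∀ {p G G'} → Move p G G' → Shifted p (balance G) (balance G')
move-shift {p} (here {rest = G} a b refl) with strip-shift p a b
... | c , s , e = c , s , balance-here a b (a + size p + b) G e
move-shift (there {n} {G} {G'} m) with move-shift m
... | c , s , e = c , s , balance-there n {G} {G'} e

move-shrinks : ∀ {p G G'} → Move p G G' → sum G' < sum G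
move-shrinks {p} (here {rest = G} a b refl) =
  subst (a + (b + sum G) <_) (insert a (size p) b (sum G)) (m<n+m _ (size-pos p))
  where
  insert : ∀ a s b S → s + (a + (b + S)) ≡ a + s + b + S
  insert = solve-∀
  size-pos : ∀ p → 0 < size p
  size-pos Left  = z<s
  size-pos Right = z<s
move-shrinks (there {n} m) = +-monoʳ-< n (move-shrinks m)

MoveBy : Player → ℤ → Position → Set
MoveBy p c G = ∃ λ G' → Move p G G' × balance G' ≡ balance G ℤ.+ c

StripMoveBy : Player → ℤ → ℕ → Set
StripMoveBy p c n = ∃₂ λ a b → a + size p + b ≡ n × weight a ℤ.+ weight b ≡ weight n ℤ.+ c

move-by-here : ∀ {p c n} G → StripMoveBy p c n → MoveBy p c (n ∷ G)
move-by-here {n = n} G (a , b , split , e) = _ , here a b split , balance-here a b n G e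

move-by-there : ∀ {p c} n {G} → MoveBy p c G → MoveBy p c (n ∷ G)
move-by-there n {G} (G' , m , e) = n ∷ G' , there m , balance-there n {G} {G'} e

long-strip-left-step : ∀ m → StripMoveBy Left 1ℤ (3 + m)
long-strip-left-step 0 = 0 , 2 , refl , refl
long-strip-left-step 1 = 0 , 3 , refl , refl
long-strip-left-step 2 = 2 , 2 , refl , refl
long-strip-left-step (suc (suc (suc m))) with long-strip-left-step m
... | a , b , split , e = a , 3 + b , trans (m+[3+n]≡3+[m+n] (a + 1) b) (cong (_+_ 3) split) , e

no-move-∷ : ∀ {p n G} → n < size p → ¬ ∃ (Move p G) → ¬ ∃ (Move p (n ∷ G))
no-move-∷ {p} n<size _ (_ , here a b refl) = <⇒≱ n<size (≤-trans (m≤n+m (size p) a) (m≤m+n _ b))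
no-move-∷ _ no-move (_ , there m) = no-move (_ , m)

0<1+d : ∀ {d} → 0ℤ ℤ.≤ d → 0ℤ ℤ.< 1ℤ ℤ.+ d
0<1+d (ℤ.+≤+ _) = ℤ.+<+ z<s

-- Left can raise the balance by one unless every strip has length 0 or 2, and then the
-- balance counts the strips of length 2.
data LeftChoice (G : Position) : Set where
  step    : MoveBy Left 1ℤ G → LeftChoice G
  jump    : ∃ (Move Left G) → 0ℤ ℤ.< balance G → LeftChoice G
  blocked : ¬ ∃ (Move Left G) → balance G ≡ 0ℤ → LeftChoice G

left-choice : ∀ G → LeftChoice G
left-choice [] = blocked (λ { (_ , ()) }) refl
left-choice (0 ∷ G) with left-choice G
... | step s           = step (move-by-there 0 s)
... | jump (_ , m) d>0 = jump (_ , there m) (subst (0ℤ ℤ.<_) (sym (ℤₚ.+-identityˡ _)) d>0)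
... | blocked none d≡0 = blocked (no-move-∷ z<s none) (trans (ℤₚ.+-identityˡ _) d≡0)
left-choice (1 ∷ G) = step (move-by-here G (0 , 0 , refl , refl))
left-choice (2 ∷ G) with left-choice G
... | step s        = step (move-by-there 2 s)
... | jump _ d>0    = jump (_ , here 0 1 refl) (0<1+d (ℤₚ.<⇒≤ d>0))
... | blocked _ d≡0 = jump (_ , here 0 1 refl) (0<1+d (ℤₚ.≤-reflexive (sym d≡0)))
left-choice (suc (suc (suc m)) ∷ G) = step (move-by-here G (long-strip-left-step m))

data RightChoice (G : Position) : Set where
  step    : MoveBy Right -1ℤ G → RightChoice G
  blocked : ¬ ∃ (Move Right G) → balance G ℤ.≤ 0ℤ → RightChoice G

right-choice : ∀ G → RightChoice G
right-choice [] = blocked (λ { (_ , ()) }) ℤₚ.≤-refl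
right-choice (0 ∷ G) with right-choice G
... | step s           = step (move-by-there 0 s)
... | blocked none d≤0 = blocked (no-move-∷ z<s none) (ℤₚ.+-monoʳ-≤ 0ℤ d≤0)
right-choice (1 ∷ G) with right-choice G
... | step s           = step (move-by-there 1 s)
... | blocked none d≤0 =
  blocked (no-move-∷ (s<s z<s) none) (ℤₚ.≤-trans (ℤₚ.+-monoʳ-≤ -1ℤ d≤0) ℤ.-≤+)
right-choice (2 ∷ G) = step (move-by-here G (0 , 0 , refl , refl))
right-choice (suc (suc (suc m)) ∷ G) =
  step (move-by-here G (1 , m , refl , ℤₚ.+-comm -1ℤ (weight m)))

_∈3ℕ+_ : ℤ → ℕ → Set
d ∈3ℕ+ r = ∃[ k ] d ≡ + (r + k * 3)

∈3ℕ+-disjoint : ∀ {d r s} → r % 3 ≢ s % 3 → d ∈3ℕ+ r → ¬ d ∈3ℕ+ s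
∈3ℕ+-disjoint {r = r} {s} r≢s (k , refl) (j , e) = r≢s (begin
  r % 3            ≡⟨ [m+kn]%n≡m%n r k 3 ⟨
  (r + k * 3) % 3  ≡⟨ cong (_% 3) (ℤₚ.+-injective e) ⟩
  (s + j * 3) % 3  ≡⟨ [m+kn]%n≡m%n s j 3 ⟩
  s % 3            ∎)

∈3ℕ+1⇒≰0 : ∀ {d} → d ∈3ℕ+ 1 → ¬ d ℤ.≤ 0ℤ
∈3ℕ+1⇒≰0 (_ , refl) (ℤ.+≤+ ())

∈3ℕ⇒+1∈3ℕ+1 : ∀ {d d'} → d ∈3ℕ+ 0 → d' ≡ d ℤ.+ 1ℤ → d' ∈3ℕ+ 1
∈3ℕ⇒+1∈3ℕ+1 (k , refl) refl = k , cong +_ (+-comm (k * 3) 1)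

∈3ℕ⁺⇒left∈3ℕ+1 : ∀ {d d'} → d ∈3ℕ+ 0 → 0ℤ ℤ.< d → Shifted Left d d' → d' ∈3ℕ+ 1
∈3ℕ⁺⇒left∈3ℕ+1 d∈ _ (_ , left-step , e) = ∈3ℕ⇒+1∈3ℕ+1 d∈ e
∈3ℕ⁺⇒left∈3ℕ+1 (suc k , refl) _ (_ , left-jump , refl) = k , refl
∈3ℕ⁺⇒left∈3ℕ+1 (zero , refl) (ℤ.+<+ ()) (_ , left-jump , _)

∈3ℕ+1⇒right∈3ℕ : ∀ {d d'} → d ∈3ℕ+ 1 → Shifted Right d d' → d' ∈3ℕ+ 0
∈3ℕ+1⇒right∈3ℕ (k , refl) (_ , right-step , refl) = k , refl
∈3ℕ+1⇒right∈3ℕ (k , refl) (_ , right-jump , refl) = suc k , cong +_ (+-comm (1 + k * 3) 2)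

mutual
  left-wins-first : ∀ {G} → Acc _<_ (sum G) → balance G ∈3ℕ+ 0 → Wins Left Left G
  left-wins-first {G} (acc rs) d∈ with left-choice G
  ... | step (_ , m , e) = good m (left-wins-second (rs (move-shrinks m)) (∈3ℕ⇒+1∈3ℕ+1 d∈ e))
  ... | jump (_ , m) d>0 =
    good m (left-wins-second (rs (move-shrinks m)) (∈3ℕ⁺⇒left∈3ℕ+1 d∈ d>0 (move-shift m)))
  ... | blocked none _   = stuck none

  left-wins-second : ∀ {G} → Acc _<_ (sum G) → balance G ∈3ℕ+ 1 → Wins Left Right G
  left-wins-second {G} (acc rs) d∈ = forced right-can-move λ m →
    left-wins-first (rs (move-shrinks m)) (∈3ℕ+1⇒right∈3ℕ d∈ (move-shift m))
    where
    right-can-move : ∃ (Move Right G)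
    right-can-move with right-choice G
    ... | step (_ , m , _) = _ , m
    ... | blocked _ d≤0    = ⊥-elim (∈3ℕ+1⇒≰0 d∈ d≤0)

  right-wins-first : ∀ {G} → Acc _<_ (sum G) → ¬ balance G ∈3ℕ+ 1 → Wins Right Right G
  right-wins-first {G} (acc rs) d∉ with right-choice G
  ... | step (_ , m , e) = good m (right-wins-second (rs (move-shrinks m)) λ d'∈ →
                                     d∉ (∈3ℕ⇒+1∈3ℕ+1 d'∈ (shift-back e)))
  ... | blocked none _   = stuck none

  right-wins-second : ∀ {G} → Acc _<_ (sum G) → ¬ balance G ∈3ℕ+ 0 → Wins Right Left G
  right-wins-second {G} (acc rs) d∉ = forced left-can-move λ m →
    right-wins-first (rs (move-shrinks m)) λ d'∈ →
      d∉ (∈3ℕ+1⇒right∈3ℕ d'∈ (shifted-left⇒right (move-shift m)))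
    where
    left-can-move : ∃ (Move Left G)
    left-can-move with left-choice G
    ... | step (_ , m , _) = _ , m
    ... | jump m _         = m
    ... | blocked _ d≡0    = ⊥-elim (d∉ (0 , d≡0))

𝓝-outcome : ∀ G → balance G ∈3ℕ+ 0 → HasOutcome G 𝓝
𝓝-outcome G d∈ =
  left-wins-first (<-wellFounded _) d∈ , right-wins-first (<-wellFounded _) (∈3ℕ+-disjoint (λ ()) d∈)

𝓟-outcome : ∀ G → balance G ∈3ℕ+ 1 → HasOutcome G 𝓟
𝓟-outcome G d∈ =
  left-wins-second (<-wellFounded _) d∈ , right-wins-second (<-wellFounded _) (∈3ℕ+-disjoint (λ ()) d∈)

𝓡-outcome : ∀ G → ¬ balance G ∈3ℕ+ 0 → ¬ balance G ∈3ℕ+ 1 → HasOutcome G 𝓡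
𝓡-outcome G d∉0 d∉1 =
  right-wins-first (<-wellFounded _) d∉1 , right-wins-second (<-wellFounded _) d∉0

weight-mod : ∀ n → weight n ≡ weight (n % 3)
weight-mod 0 = refl
weight-mod 1 = refl
weight-mod 2 = refl
weight-mod (suc (suc (suc n))) = weight-mod n

count-accept : ∀ r n G → n % 3 ≡ r → count r (n ∷ G) ≡ suc (count r G)
count-accept r n G n≡r = cong length (filter-accept (λ m → m % 3 ≟ r) {n} {G} n≡r)

count-reject : ∀ {s} r n G → n % 3 ≡ s → s ≢ r → count r (n ∷ G) ≡ count r G
count-reject r n G n≡s s≢r =
  cong length (filter-reject (λ m → m % 3 ≟ r) {n} {G} (s≢r ∘ trans (sym n≡s)))

balance-counts : ∀ G → balance G ≡ count 2 G ⊖ count 1 G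
balance-counts [] = refl
balance-counts (n ∷ G) = begin
  weight n ℤ.+ balance G             ≡⟨ cong₂ ℤ._+_ (weight-mod n) (balance-counts G) ⟩
  weight (n % 3) ℤ.+ (y ⊖ x)         ≡⟨ by-residue (n % 3) refl (m%n<n n 3) ⟩
  count 2 (n ∷ G) ⊖ count 1 (n ∷ G)  ∎
  where
  x y : ℕ
  x = count 1 G
  y = count 2 G
  recount : ∀ {y' x'} → count 2 (n ∷ G) ≡ y' → count 1 (n ∷ G) ≡ x' →
            y' ⊖ x' ≡ count 2 (n ∷ G) ⊖ count 1 (n ∷ G)
  recount e₂ e₁ = sym (cong₂ _⊖_ e₂ e₁)
  by-residue : ∀ r → n % 3 ≡ r → r < 3 →
               weight r ℤ.+ (y ⊖ x) ≡ count 2 (n ∷ G) ⊖ count 1 (n ∷ G)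
  by-residue 0 n≡r _ = trans (ℤₚ.+-identityˡ (y ⊖ x))
    (recount (count-reject 2 n G n≡r (λ ())) (count-reject 1 n G n≡r (λ ())))
  by-residue 1 n≡r _ = trans (ℤₚ.distribʳ-⊖-+-neg 0 y x)
    (recount (count-reject 2 n G n≡r (λ ())) (count-accept 1 n G n≡r))
  by-residue 2 n≡r _ = trans (ℤₚ.distribʳ-⊖-+-pos 1 y x)
    (recount (count-accept 2 n G n≡r) (count-reject 1 n G n≡r (λ ())))
  by-residue (suc (suc (suc _))) _ (s≤s (s≤s (s≤s ())))

residue-of-offset : ∀ x m → (x + 2 * (x + m)) % 3 ≡ (2 * m) % 3
residue-of-offset x m = trans (cong (_% 3) (rearrange x m)) ([m+kn]%n≡m%n (2 * m) x 3)
  where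
  rearrange : ∀ x m → x + 2 * (x + m) ≡ 2 * m + x * 3
  rearrange = solve-∀

%3-by-doubling : ∀ a → a % 3 ≡ (2 * ((2 * a) % 3)) % 3
%3-by-doubling a = begin
  a % 3                    ≡⟨ [m+kn]%n≡m%n a a 3 ⟨
  (a + a * 3) % 3          ≡⟨ cong (_% 3) (quadruple a) ⟩
  (2 * (2 * a)) % 3        ≡⟨ %-distribˡ-* 2 (2 * a) 3 ⟩
  (2 * ((2 * a) % 3)) % 3  ∎
  where
  quadruple : ∀ a → a + a * 3 ≡ 2 * (2 * a)
  quadruple = solve-∀

-- x + 2y ≡ 2(y − x) (mod 3), and doubling is invertible mod 3.
offset-from-residue : ∀ {x y r} → x ≤ y → r < 3 → (x + 2 * y) % 3 ≡ (2 * r) % 3 →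
                      ∃[ k ] y ∸ x ≡ r + k * 3
offset-from-residue {x} {y} {r} x≤y r<3 residue = (y ∸ x) / 3 , (begin
  y ∸ x                          ≡⟨ m≡m%n+[m/n]*n (y ∸ x) 3 ⟩
  (y ∸ x) % 3 + (y ∸ x) / 3 * 3  ≡⟨ cong (_+ (y ∸ x) / 3 * 3) offset%3 ⟩
  r + (y ∸ x) / 3 * 3            ∎)
  where
  offset%3 : (y ∸ x) % 3 ≡ r
  offset%3 = begin
    (y ∸ x) % 3                    ≡⟨ %3-by-doubling (y ∸ x) ⟩
    (2 * ((2 * (y ∸ x)) % 3)) % 3  ≡⟨ cong (λ t → (2 * t) % 3) (begin
      (2 * (y ∸ x)) % 3              ≡⟨ residue-of-offset x (y ∸ x) ⟨
      (x + 2 * (x + (y ∸ x))) % 3    ≡⟨ cong (λ z → (x + 2 * z) % 3) (m+[n∸m]≡n x≤y) ⟩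
      (x + 2 * y) % 3                ≡⟨ residue ⟩
      (2 * r) % 3                    ∎) ⟩
    (2 * ((2 * r) % 3)) % 3        ≡⟨ %3-by-doubling r ⟨
    r % 3                          ≡⟨ m<n⇒m%n≡m r<3 ⟩
    r                              ∎

balance∈3ℕ+ : ∀ G {r} → count 1 G ≤ count 2 G → r < 3 →
              (count 1 G + 2 * count 2 G) % 3 ≡ (2 * r) % 3 → balance G ∈3ℕ+ r
balance∈3ℕ+ G x≤y r<3 residue with offset-from-residue x≤y r<3 residue
... | k , e = k , trans (balance-counts G) (trans (ℤₚ.≤-⊖ x≤y) (cong +_ e))

balance∉3ℕ+ : ∀ G {r} → count 2 G < count 1 G → ¬ balance G ∈3ℕ+ r
balance∉3ℕ+ G y<x (_ , e)
  with trans (cong ℤ.sign (trans (sym e) (balance-counts G))) (ℤₚ.sign-⊖-< y<x)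
... | ()

theorem4p4 : (G : Position) →
    let x = count 1 G
        y = count 2 G
    in ((x ≡ y ⊎ (x < y × (x + 2 * y) % 3 ≡ 0)) → HasOutcome G 𝓝)
     × ((x > y ⊎ (x < y × (x + 2 * y) % 3 ≡ 1)) → HasOutcome G 𝓡)
     × ((x < y × (x + 2 * y) % 3 ≡ 2) → HasOutcome G 𝓟)
theorem4p4 G = 𝓝-case , 𝓡-case , 𝓟-case
  where
  x y : ℕ
  x = count 1 G
  y = count 2 G
  𝓝-case : (x ≡ y ⊎ (x < y × (x + 2 * y) % 3 ≡ 0)) → HasOutcome G 𝓝
  𝓝-case (inj₁ x≡y) =
    𝓝-outcome G (0 , trans (balance-counts G) (trans (cong (y ⊖_) x≡y) (ℤₚ.n⊖n≡0 y)))
  𝓝-case (inj₂ (x<y , residue)) = 𝓝-outcome G (balance∈3ℕ+ G (<⇒≤ x<y) z<s residue)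
  𝓡-case : (x > y ⊎ (x < y × (x + 2 * y) % 3 ≡ 1)) → HasOutcome G 𝓡
  𝓡-case (inj₁ y<x) = 𝓡-outcome G (balance∉3ℕ+ G y<x) (balance∉3ℕ+ G y<x)
  𝓡-case (inj₂ (x<y , residue)) = 𝓡-outcome G (∈3ℕ+-disjoint (λ ()) d∈) (∈3ℕ+-disjoint (λ ()) d∈)
    where
    d∈ : balance G ∈3ℕ+ 2
    d∈ = balance∈3ℕ+ G (<⇒≤ x<y) (s<s (s<s z<s)) residue
  𝓟-case : (x < y × (x + 2 * y) % 3 ≡ 2) → HasOutcome G 𝓟
  𝓟-case (x<y , residue) = 𝓟-outcome G (balance∈3ℕ+ G (<⇒≤ x<y) (s<s z<s) residue)
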